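{- Let $G=(A,B,E)$ be a bipartite graph with maximum matching $M^*$, whose edges arrive in an arbitrary order, and let $\lambda\ge2$ be an integer. Let $S=\mathrm{SEMI}(\lambda)$ be the output of the algorithm that starts with $S=\emptyset$ and, upon arrival of each edge $ab$ ($a\in A$, $b\in B$), adds $ab$ to $S$ if $\deg_S(a)=0$ and $\deg_S(b)\le\lambda-1$. Then $S$ is an incomplete $\lambda$-bounded semi-matching with $|A(S)|\ge\frac{\lambda}{\lambda+1}|M^*|$.
   Context: An incomplete $\lambda$-bounded semi-matching of $G$ is a subset $S\subseteq E$ with $\deg_S(a)\le1$ for all $a\in A$ and $\deg_S(b)\le\lambda$ for all $b\in B$, where $\deg_S(v)$ is the number of edges of $S$ incident to $v$. $A(S)$ is the set of vertices of $A$ covered by $S$. -}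

module Defs where

open import Data.Nat using (ℕ; zero; suc; _≤_; _<_; _≤?_; _<?_)
open import Data.Fin using (Fin; _≟_)
open import Data.Fin.Properties using (_≟_)
open import Data.List using (List; []; _∷_; _++_; [_]; length; filter; allFin)
open import Data.List.Membership.Propositional using (_∈_)
open import Data.List.Relation.Unary.Unique.Propositional using (Unique)
open import Data.Product using (_×_; _,_; proj₁; proj₂)
open import Data.Bool using (if_then_else_; _∧_)
open import Relation.Nullary using (does)
open import Relation.Binary.PropositionalEquality using (_≡_)

-- Bipartite graph G = (A, B, E) with A = Fin m, B = Fin n.
-- An edge ab is a pair (a , b).  Edge sets / streams are lists.
Edge : ℕ → ℕ → Set
Edge m n = Fin m × Fin n

degA : ∀ {m n} → List (Edge m n) → Fin m → ℕ
degA S a = length (filter (λ e → proj₁ e ≟ a) S)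

degB : ∀ {m n} → List (Edge m n) → Fin n → ℕ
degB S b = length (filter (λ e → proj₂ e ≟ b) S)

semiStep : ∀ {m n} → ℕ → List (Edge m n) → Edge m n → List (Edge m n)
semiStep lam S (a , b) =
  if does (degA S a ≟ℕ 0) ∧ does (degB S b <? lam) then S ++ [ (a , b) ] else S
  where open import Data.Nat using () renaming (_≟_ to _≟ℕ_)

semiRun : ∀ {m n} → ℕ → List (Edge m n) → List (Edge m n) → List (Edge m n)
semiRun lam S []       = S
semiRun lam S (e ∷ es) = semiRun lam (semiStep lam S e) es

SEMI : ∀ {m n} → ℕ → List (Edge m n) → List (Edge m n)
SEMI lam E = semiRun lam [] E

-- S ⊆ E (as a set of edges: duplicate-free, every element an edge of E)
IsEdgeSubset : ∀ {m n} → List (Edge m n) → List (Edge m n) → Set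
IsEdgeSubset E S = Unique S × (∀ {e} → e ∈ S → e ∈ E)

IsMatching : ∀ {m n} → List (Edge m n) → List (Edge m n) → Set
IsMatching {m} {n} E M =
  IsEdgeSubset E M × (∀ (a : Fin m) → degA M a ≤ 1) × (∀ (b : Fin n) → degB M b ≤ 1)

-- maximum matching of G (|M| = length M since M is duplicate-free)
IsMaximumMatching : ∀ {m n} → List (Edge m n) → List (Edge m n) → Set
IsMaximumMatching E M =
  IsMatching E M × (∀ M' → IsMatching E M' → length M' ≤ length M)

IsIncompleteSemiMatching : ∀ {m n} → ℕ → List (Edge m n) → List (Edge m n) → Set
IsIncompleteSemiMatching {m} {n} lam E S =
  IsEdgeSubset E S × (∀ (a : Fin m) → degA S a ≤ 1) × (∀ (b : Fin n) → degB S b ≤ lam)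

coveredA : ∀ {m n} → List (Edge m n) → ℕ
coveredA {m} S = length (filter (λ a → 1 ≤? degA S a) (allFin m))

-- An edge ab rejected by SEMI(λ) is blocked: a is already covered or b already has λ edges,
-- and an edge stays blocked once it is, so at the end every edge of M* is blocked by S.
-- Give each e ∈ M* the weight λ·deg_S(a_e) + deg_S(b_e) ≥ λ. Since M* is a matching, an edge
-- of S is counted at most once through its A-endpoint and once through its B-endpoint, so
-- λ|M*| ≤ (λ+1)|S|; and |S| = |A(S)| because every vertex of A has S-degree at most 1.
module Submission where

open import Defs
open import Data.Nat using (ℕ; zero; suc; z≤n; s≤s; _≤_; _<_; _+_; _*_; _≤?_; _<?_; _≟_)
open import Data.List using (List; []; _∷_; _++_; [_]; length; map; filter; allFin)
open import Data.Product using (_×_; _,_; proj₁; proj₂)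
open import Data.List.Relation.Unary.Unique.Propositional using (Unique)
open import Level using (Level)
open import Function using (_∘_; id)
open import Data.Bool using (if_then_else_; _∧_)
open import Data.Empty using (⊥-elim)
import Data.Fin.Properties as Fin
open import Data.Nat.Properties
open import Data.Nat.ListAction using (sum)
open import Data.List.Properties using (map-cong; length-++; filter-++; filter-some; filter-reject; length-filter)
open import Data.List.Membership.Propositional using (_∈_)
open import Data.List.Membership.Propositional.Properties using (∈-++⁺ʳ; ∈-++⁻; ∈-allFin)
open import Data.List.Relation.Unary.Any as Any using (here; there)
open import Data.List.Relation.Unary.All using () renaming ([] to []ᴬ)
open import Data.List.Relation.Unary.AllPairs using () renaming ([] to []ᴬᴾ; _∷_ to _∷ᴬᴾ_)
open import Data.List.Relation.Unary.Unique.Propositional.Properties using (++⁺)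
open import Data.Sum using (_⊎_; inj₁; inj₂)
open import Algebra.Properties.CommutativeSemigroup +-commutativeSemigroup using (interchange)
open import Relation.Nullary using (Dec; yes; no; does; ¬_)
open import Relation.Unary using (Pred; Decidable)
open import Relation.Binary.Definitions using (DecidableEquality)
open import Relation.Binary.PropositionalEquality using (_≡_; _≢_; refl; sym; trans; cong; subst; module ≡-Reasoning)

private variable
  ℓ p : Level
  X Y : Set ℓ

χ : {P : Set p} → Dec P → ℕ
χ P? = if does P? then 1 else 0

∑ : List X → (X → ℕ) → ℕ
∑ xs f = sum (map f xs)

infixr 5 ∑
syntax ∑ xs (λ x → t) = ∑[ x ∈ xs ] t

∑-cong : ∀ (xs : List X) {f g : X → ℕ} → (∀ x → f x ≡ g x) → ∑ xs f ≡ ∑ xs g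
∑-cong xs f≗g = cong sum (map-cong f≗g xs)

∑-mono : ∀ (xs : List X) {f g : X → ℕ} → (∀ {x} → x ∈ xs → f x ≤ g x) → ∑ xs f ≤ ∑ xs g
∑-mono []       f≤g = z≤n
∑-mono (x ∷ xs) f≤g = +-mono-≤ (f≤g (here refl)) (∑-mono xs (f≤g ∘ there))

∑-const : ∀ (xs : List X) c → ∑[ x ∈ xs ] c ≡ c * length xs
∑-const []       c = sym (*-zeroʳ c)
∑-const (x ∷ xs) c = trans (cong (c +_) (∑-const xs c)) (sym (*-suc c (length xs)))

∑-*ˡ : ∀ (xs : List X) c (f : X → ℕ) → ∑[ x ∈ xs ] c * f x ≡ c * ∑ xs f
∑-*ˡ []       c f = sym (*-zeroʳ c)
∑-*ˡ (x ∷ xs) c f = trans (cong (c * f x +_) (∑-*ˡ xs c f)) (sym (*-distribˡ-+ c (f x) _))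

∑-+ : ∀ (xs : List X) (f g : X → ℕ) → ∑[ x ∈ xs ] (f x + g x) ≡ ∑ xs f + ∑ xs g
∑-+ []       f g = refl
∑-+ (x ∷ xs) f g = trans (cong (f x + g x +_) (∑-+ xs f g)) (interchange (f x) (g x) _ _)

∑-comm : ∀ (xs : List X) (ys : List Y) (h : X → Y → ℕ) →
         ∑[ x ∈ xs ] ∑[ y ∈ ys ] h x y ≡ ∑[ y ∈ ys ] ∑[ x ∈ xs ] h x y
∑-comm []       ys h = sym (∑-const ys 0)
∑-comm (x ∷ xs) ys h = begin
  ∑ ys (h x) + (∑[ x′ ∈ xs ] ∑[ y ∈ ys ] h x′ y)  ≡⟨ cong (∑ ys (h x) +_) (∑-comm xs ys h) ⟩
  ∑ ys (h x) + (∑[ y ∈ ys ] ∑[ x′ ∈ xs ] h x′ y)  ≡⟨ ∑-+ ys (h x) (λ y → ∑[ x′ ∈ xs ] h x′ y) ⟨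
  ∑[ y ∈ ys ] (h x y + (∑[ x′ ∈ xs ] h x′ y))     ∎
  where open ≡-Reasoning

length-filter≡∑χ : ∀ {P : Pred X p} (P? : Decidable P) xs → length (filter P? xs) ≡ ∑[ x ∈ xs ] χ (P? x)
length-filter≡∑χ P? []       = refl
length-filter≡∑χ P? (x ∷ xs) with P? x
... | yes _ = cong suc (length-filter≡∑χ P? xs)
... | no _  = length-filter≡∑χ P? xs

module Multiplicity {V : Set ℓ} (_≟ᵥ_ : DecidableEquality V) where

  count : (X → V) → List X → V → ℕ
  count f xs v = length (filter (λ x → f x ≟ᵥ v) xs)

  χ-sym : ∀ u v → χ (u ≟ᵥ v) ≡ χ (v ≟ᵥ u)
  χ-sym u v with u ≟ᵥ v | v ≟ᵥ u
  ... | yes _   | yes _   = refl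
  ... | no _    | no _    = refl
  ... | yes u≡v | no v≢u  = ⊥-elim (v≢u (sym u≡v))
  ... | no u≢v  | yes v≡u = ⊥-elim (u≢v (sym v≡u))

  count-++ : ∀ (f : X → V) xs ys v → count f (xs ++ ys) v ≡ count f xs v + count f ys v
  count-++ f xs ys v = trans (cong length (filter-++ (λ x → f x ≟ᵥ v) xs ys)) (length-++ (filter _ xs))

  count-++-[]-≢ : ∀ (f : X → V) xs {x v} → f x ≢ v → count f (xs ++ [ x ]) v ≡ count f xs v
  count-++-[]-≢ f xs {x} {v} fx≢v = begin
    count f (xs ++ [ x ]) v        ≡⟨ count-++ f xs [ x ] v ⟩
    count f xs v + count f [ x ] v ≡⟨ cong (count f xs v +_) (cong length (filter-reject (λ y → f y ≟ᵥ v) fx≢v)) ⟩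
    count f xs v + 0               ≡⟨ +-identityʳ _ ⟩
    count f xs v                   ∎
    where open ≡-Reasoning

  count-++-[]≤ : ∀ (f : X → V) xs x v → count f (xs ++ [ x ]) v ≤ suc (count f xs v)
  count-++-[]≤ f xs x v = begin
    count f (xs ++ [ x ]) v        ≡⟨ count-++ f xs [ x ] v ⟩
    count f xs v + count f [ x ] v ≤⟨ +-monoʳ-≤ (count f xs v) (length-filter (λ y → f y ≟ᵥ v) [ x ]) ⟩
    count f xs v + 1               ≡⟨ +-comm (count f xs v) 1 ⟩
    suc (count f xs v)             ∎
    where open ≤-Reasoning

  ∈⇒1≤count : ∀ (f : X → V) {x xs} → x ∈ xs → 1 ≤ count f xs (f x)
  ∈⇒1≤count f {x} x∈xs = filter-some (λ y → f y ≟ᵥ f x) (Any.map (λ x≡y → cong f (sym x≡y)) x∈xs)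

  count≡∑χ : ∀ (f : X → V) xs v → count f xs v ≡ ∑[ x ∈ xs ] χ (f x ≟ᵥ v)
  count≡∑χ f xs v = length-filter≡∑χ (λ x → f x ≟ᵥ v) xs

  -- Both sides count the pairs (x , y) ∈ xs × ys with f x = g y.
  ∑-count-comm : ∀ (f : X → V) (g : Y → V) xs ys →
                 ∑[ x ∈ xs ] count g ys (f x) ≡ ∑[ y ∈ ys ] count f xs (g y)
  ∑-count-comm f g xs ys = begin
    ∑[ x ∈ xs ] count g ys (f x)              ≡⟨ ∑-cong xs (λ x → count≡∑χ g ys (f x)) ⟩
    ∑[ x ∈ xs ] ∑[ y ∈ ys ] χ (g y ≟ᵥ f x)    ≡⟨ ∑-comm xs ys (λ x y → χ (g y ≟ᵥ f x)) ⟩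
    ∑[ y ∈ ys ] ∑[ x ∈ xs ] χ (g y ≟ᵥ f x)    ≡⟨ ∑-cong ys (λ y → ∑-cong xs (λ x → χ-sym (g y) (f x))) ⟩
    ∑[ y ∈ ys ] ∑[ x ∈ xs ] χ (f x ≟ᵥ g y)    ≡⟨ ∑-cong ys (λ y → count≡∑χ f xs (g y)) ⟨
    ∑[ y ∈ ys ] count f xs (g y)              ∎
    where open ≡-Reasoning

  ∑-count≤length : ∀ (f : X → V) (g : Y → V) xs ys → (∀ v → count f xs v ≤ 1) →
                   ∑[ x ∈ xs ] count g ys (f x) ≤ length ys
  ∑-count≤length f g xs ys count≤1 = begin
    ∑[ x ∈ xs ] count g ys (f x)  ≡⟨ ∑-count-comm f g xs ys ⟩
    ∑[ y ∈ ys ] count f xs (g y)  ≤⟨ ∑-mono ys (λ {y} _ → count≤1 (g y)) ⟩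
    ∑[ y ∈ ys ] 1                 ≡⟨ ∑-const ys 1 ⟩
    1 * length ys                 ≡⟨ *-identityˡ (length ys) ⟩
    length ys                     ∎
    where open ≤-Reasoning

  length≤image : ∀ (f : X → V) xs (vs : List V) → (∀ v → count f xs v ≤ 1) → (∀ x → f x ∈ vs) →
                 length xs ≤ length (filter (λ v → 1 ≤? count f xs v) vs)
  length≤image f xs vs count≤1 f∈vs = begin
    length xs                                     ≡⟨ *-identityˡ (length xs) ⟨
    1 * length xs                                 ≡⟨ ∑-const xs 1 ⟨
    ∑[ x ∈ xs ] 1                                 ≤⟨ ∑-mono xs (λ {x} _ → ∈⇒1≤count id (f∈vs x)) ⟩
    ∑[ x ∈ xs ] count id vs (f x)                 ≡⟨ ∑-count-comm f id xs vs ⟩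
    ∑[ v ∈ vs ] count f xs v                      ≤⟨ ∑-mono vs (λ {v} _ → ≤1⇒≤χ (count≤1 v)) ⟩
    ∑[ v ∈ vs ] χ (1 ≤? count f xs v)             ≡⟨ length-filter≡∑χ (λ v → 1 ≤? count f xs v) vs ⟨
    length (filter (λ v → 1 ≤? count f xs v) vs)  ∎
    where
    open ≤-Reasoning
    ≤1⇒≤χ : ∀ {k} → k ≤ 1 → k ≤ χ (1 ≤? k)
    ≤1⇒≤χ {zero}  _ = z≤n
    ≤1⇒≤χ {suc _} (s≤s z≤n) = s≤s z≤n

open module MultiplicityFin {k} = Multiplicity (Fin._≟_ {k})

module _ {m n : ℕ} where

  Blocked : ℕ → List (Edge m n) → Edge m n → Set
  Blocked lam S (a , b) = 1 ≤ degA S a ⊎ lam ≤ degB S b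

  IsSemiMatching : ℕ → List (Edge m n) → Set
  IsSemiMatching lam S = Unique S × (∀ a → degA S a ≤ 1) × (∀ b → degB S b ≤ lam)

  Blocked-++ : ∀ {lam} S T {e} → Blocked lam S e → Blocked lam (S ++ T) e
  Blocked-++ S T {a , b} (inj₁ a-covered) =
    inj₁ (≤-trans a-covered (≤-trans (m≤m+n _ _) (≤-reflexive (sym (count-++ proj₁ S T a)))))
  Blocked-++ S T {a , b} (inj₂ b-full) =
    inj₂ (≤-trans b-full (≤-trans (m≤m+n _ _) (≤-reflexive (sym (count-++ proj₂ S T b)))))

  data StepCase (lam : ℕ) (S : List (Edge m n)) : Edge m n → List (Edge m n) → Set where
    accepted : ∀ {a b} → degA S a ≡ 0 → degB S b < lam → StepCase lam S (a , b) (S ++ [ (a , b) ])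
    rejected : ∀ {e} → Blocked lam S e → StepCase lam S e S

  stepCase : ∀ lam S e → StepCase lam S e (semiStep lam S e)
  stepCase lam S (a , b) = classify (degA S a ≟ 0) (degB S b <? lam)
    where
    classify : (a? : Dec (degA S a ≡ 0)) (b? : Dec (degB S b < lam)) →
               StepCase lam S (a , b) (if does a? ∧ does b? then S ++ [ (a , b) ] else S)
    classify (yes a-free) (yes b-free) = accepted a-free b-free
    classify (yes _)      (no b-full)  = rejected (inj₂ (≮⇒≥ b-full))
    classify (no a-taken) _            = rejected (inj₁ (n≢0⇒n>0 a-taken))

  step-blocks : ∀ lam S e → Blocked lam (semiStep lam S e) e
  step-blocks lam S e with semiStep lam S e | stepCase lam S e
  ... | _ | accepted _ _ = inj₁ (∈⇒1≤count proj₁ (∈-++⁺ʳ S (here refl)))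
  ... | _ | rejected blocked = blocked

  step-preserves-Blocked : ∀ lam S e′ {e} → Blocked lam S e → Blocked lam (semiStep lam S e′) e
  step-preserves-Blocked lam S e′ blocked with semiStep lam S e′ | stepCase lam S e′
  ... | _ | accepted _ _ = Blocked-++ S _ blocked
  ... | _ | rejected _   = blocked

  step-⊆ : ∀ lam S e {x} → x ∈ semiStep lam S e → x ∈ S ⊎ x ≡ e
  step-⊆ lam S e x∈ with semiStep lam S e | stepCase lam S e
  ... | _ | rejected _ = inj₁ x∈
  ... | _ | accepted _ _ with ∈-++⁻ S x∈
  ...   | inj₁ x∈S       = inj₁ x∈S
  ...   | inj₂ (here x≡e) = inj₂ x≡e

  step-preserves-IsSemiMatching : ∀ lam S e → IsSemiMatching lam S → IsSemiMatching lam (semiStep lam S e)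
  step-preserves-IsSemiMatching lam S e inv@(unique , degA≤1 , degB≤lam) with semiStep lam S e | stepCase lam S e
  ... | _ | rejected _ = inv
  ... | _ | accepted {a} {b} a-free b-free = ++⁺ unique ([]ᴬ ∷ᴬᴾ []ᴬᴾ) fresh , degA≤1′ , degB≤lam′
    where
    fresh : ∀ {e′} → ¬ (e′ ∈ S × e′ ∈ [ (a , b) ])
    fresh (e∈S , here refl) = 1+n≰n (subst (1 ≤_) a-free (∈⇒1≤count proj₁ e∈S))
    degA≤1′ : ∀ a′ → degA (S ++ [ (a , b) ]) a′ ≤ 1
    degA≤1′ a′ with a Fin.≟ a′
    ... | yes refl = ≤-trans (count-++-[]≤ proj₁ S (a , b) a) (s≤s (≤-reflexive a-free))
    ... | no a≢a′  = ≤-trans (≤-reflexive (count-++-[]-≢ proj₁ S a≢a′)) (degA≤1 a′)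
    degB≤lam′ : ∀ b′ → degB (S ++ [ (a , b) ]) b′ ≤ lam
    degB≤lam′ b′ with b Fin.≟ b′
    ... | yes refl = ≤-trans (count-++-[]≤ proj₂ S (a , b) b) b-free
    ... | no b≢b′  = ≤-trans (≤-reflexive (count-++-[]-≢ proj₂ S b≢b′)) (degB≤lam b′)

  run-preserves-Blocked : ∀ lam S es {e} → Blocked lam S e → Blocked lam (semiRun lam S es) e
  run-preserves-Blocked lam S []        blocked = blocked
  run-preserves-Blocked lam S (e′ ∷ es) blocked =
    run-preserves-Blocked lam (semiStep lam S e′) es (step-preserves-Blocked lam S e′ blocked)

  run-blocks : ∀ lam S es {e} → e ∈ es → Blocked lam (semiRun lam S es) e
  run-blocks lam S (e ∷ es) (here refl) = run-preserves-Blocked lam (semiStep lam S e) es (step-blocks lam S e)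
  run-blocks lam S (e′ ∷ es) (there e∈es) = run-blocks lam (semiStep lam S e′) es e∈es

  run-⊆ : ∀ lam S es {x} → x ∈ semiRun lam S es → x ∈ S ⊎ x ∈ es
  run-⊆ lam S []       x∈ = inj₁ x∈
  run-⊆ lam S (e ∷ es) x∈ with run-⊆ lam (semiStep lam S e) es x∈
  ... | inj₂ x∈es = inj₂ (there x∈es)
  ... | inj₁ x∈S′ with step-⊆ lam S e x∈S′
  ...   | inj₁ x∈S  = inj₁ x∈S
  ...   | inj₂ refl = inj₂ (here refl)

  run-preserves-IsSemiMatching : ∀ lam S es → IsSemiMatching lam S → IsSemiMatching lam (semiRun lam S es)
  run-preserves-IsSemiMatching lam S []       inv = inv
  run-preserves-IsSemiMatching lam S (e ∷ es) inv =
    run-preserves-IsSemiMatching lam (semiStep lam S e) es (step-preserves-IsSemiMatching lam S e inv)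

  SEMI-isSemiMatching : ∀ lam E → IsSemiMatching lam (SEMI lam E)
  SEMI-isSemiMatching lam E = run-preserves-IsSemiMatching lam [] E ([]ᴬᴾ , (λ _ → z≤n) , (λ _ → z≤n))

  SEMI-⊆ : ∀ lam E {e} → e ∈ SEMI lam E → e ∈ E
  SEMI-⊆ lam E e∈S with run-⊆ lam [] E e∈S
  ... | inj₂ e∈E = e∈E

  blocked⇒weight : ∀ lam S e → Blocked lam S e → lam ≤ lam * degA S (proj₁ e) + degB S (proj₂ e)
  blocked⇒weight lam S (a , b) (inj₁ a-covered) = begin
    lam                             ≡⟨ *-identityʳ lam ⟨
    lam * 1                         ≤⟨ *-monoʳ-≤ lam a-covered ⟩
    lam * degA S a                  ≤⟨ m≤m+n _ _ ⟩
    lam * degA S a + degB S b       ∎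
    where open ≤-Reasoning
  blocked⇒weight lam S (a , b) (inj₂ b-full) = ≤-trans b-full (m≤n+m _ _)

  blocked-matching-≤ : ∀ lam S M → (∀ a → degA M a ≤ 1) → (∀ b → degB M b ≤ 1) →
                       (∀ {e} → e ∈ M → Blocked lam S e) → lam * length M ≤ (lam + 1) * length S
  blocked-matching-≤ lam S M degA≤1 degB≤1 blocked = begin
    lam * length M                                                  ≡⟨ ∑-const M lam ⟨
    ∑[ e ∈ M ] lam                                                  ≤⟨ ∑-mono M (λ e∈M → blocked⇒weight lam S _ (blocked e∈M)) ⟩
    ∑[ e ∈ M ] (lam * degA S (proj₁ e) + degB S (proj₂ e))          ≡⟨ ∑-+ M _ _ ⟩
    (∑[ e ∈ M ] lam * degA S (proj₁ e)) + (∑[ e ∈ M ] degB S (proj₂ e))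
                                                                    ≡⟨ cong (_+ _) (∑-*ˡ M lam _) ⟩
    lam * (∑[ e ∈ M ] degA S (proj₁ e)) + (∑[ e ∈ M ] degB S (proj₂ e))
                                                                    ≤⟨ +-mono-≤ (*-monoʳ-≤ lam (∑-count≤length proj₁ proj₁ M S degA≤1))
                                                                                (∑-count≤length proj₂ proj₂ M S degB≤1) ⟩
    lam * length S + length S                                       ≡⟨ cong (lam * length S +_) (*-identityˡ (length S)) ⟨
    lam * length S + 1 * length S                                   ≡⟨ *-distribʳ-+ (length S) lam 1 ⟨
    (lam + 1) * length S                                            ∎
    where open ≤-Reasoning

  length≤coveredA : ∀ S → (∀ a → degA S a ≤ 1) → length S ≤ coveredA S
  length≤coveredA S degA≤1 = length≤image {X = Edge m n} proj₁ S (allFin m) degA≤1 (λ e → ∈-allFin (proj₁ e))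

lemma10 : ∀ {m n : ℕ} (E : List (Edge m n)) → Unique E →
    (Mstar : List (Edge m n)) → IsMaximumMatching E Mstar →
    (lam : ℕ) → 2 ≤ lam →
    IsIncompleteSemiMatching lam E (SEMI lam E)
      × (lam * length Mstar ≤ (lam + 1) * coveredA (SEMI lam E))
-- The bound holds for every λ.
lemma10 E _ Mstar (((_ , Mstar⊆E) , degA≤1 , degB≤1) , _) lam _ =
  let S = SEMI lam E
      (unique , S-degA≤1 , S-degB≤lam) = SEMI-isSemiMatching lam E
  in ((unique , SEMI-⊆ lam E) , S-degA≤1 , S-degB≤lam) ,
     (begin
       lam * length Mstar     ≤⟨ blocked-matching-≤ lam S Mstar degA≤1 degB≤1 (run-blocks lam [] E ∘ Mstar⊆E) ⟩
       (lam + 1) * length S   ≤⟨ *-monoʳ-≤ (lam + 1) (length≤coveredA S S-degA≤1) ⟩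
       (lam + 1) * coveredA S ∎)
  where open ≤-Reasoning
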